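{- Let $\pi\in\mathfrak{S}_n$ with rix-factorization $\pi=\alpha_1\cdots\alpha_k\beta$, and let $y\in\mathrm{Rix}(\pi)$. Then $y$ is a valley of $\pi$ if $y=\beta_1(\pi)$, and $y$ is a double ascent of $\pi$ otherwise.
   Context: One-line notation with $\pi_0=\pi_{n+1}=\infty$; a letter $\pi_i$ is a valley if $\pi_{i-1}>\pi_i<\pi_{i+1}$, a double ascent if $\pi_{i-1}<\pi_i<\pi_{i+1}$. Rix-factorization $\pi=\alpha_1\cdots\alpha_k\beta$: (1) $w:=\pi$, $i:=0$; (2) if $w$ increasing, $\beta:=w$, stop; else $i:=i+1$, let $x$ be the largest descent of the word $w$ (letter larger than its right neighbour in $w$), write $w=w'xw''$; (3) if $w'$ empty, $\beta:=w$, stop; else $\alpha_i:=w'x$, $w:=w''$, go to (2). $\beta_1(\pi)$ is the first letter of $\beta$. A rixed point of $\pi$ is a letter of the maximal increasing suffix of $\pi$ not smaller than $\beta_1(\pi)$; $\mathrm{Rix}(\pi)$ is their set. -}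

module Defs where

open import Data.Nat using (ℕ; zero; suc; _<_; _≤_; _<ᵇ_; _≡ᵇ_; _⊔_)
open import Data.Bool using (Bool; true; false; if_then_else_; _∧_)
open import Data.List using (List; []; _∷_; _++_; length; foldr; null; head; last; map; upTo)
open import Data.List.Membership.Propositional using (_∈_)
open import Data.Maybe using (Maybe; just; nothing)
open import Data.Product using (_×_; _,_; ∃-syntax; proj₁; proj₂)
open import Data.Unit using (⊤)
open import Data.Empty using (⊥)
open import Relation.Binary.PropositionalEquality using (_≡_)
open import Data.List.Relation.Binary.Permutation.Propositional using (_↭_)

IsPerm : ℕ → List ℕ → Set
IsPerm n π = π ↭ map suc (upTo n)

descents : List ℕ → List ℕ
descents (a ∷ b ∷ w) = if b <ᵇ a then a ∷ descents (b ∷ w) else descents (b ∷ w)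
descents _ = []

isIncreasing : List ℕ → Bool
isIncreasing w = null (descents w)

-- largest descent (meaningful when the word is not increasing)
largestDescent : List ℕ → ℕ
largestDescent w = foldr _⊔_ 0 (descents w)

splitAround : ℕ → List ℕ → List ℕ × List ℕ
splitAround x [] = [] , []
splitAround x (a ∷ w) =
  if a ≡ᵇ x then ([] , w) else (a ∷ proj₁ (splitAround x w) , proj₂ (splitAround x w))

-- The fuel argument bounds the number of iterations; each iteration strictly
-- shortens the current word, so fuel = length π is always sufficient.
rixβ-fuel : ℕ → List ℕ → List ℕ
rixβ-fuel zero w = w
rixβ-fuel (suc f) w with isIncreasing w
... | true = w
... | false with splitAround (largestDescent w) w
...   | ([] , _) = w
...   | (_ ∷ _ , w'') = rixβ-fuel f w''

rixβ : List ℕ → List ℕ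
rixβ π = rixβ-fuel (length π) π

β₁ : List ℕ → Maybe ℕ
β₁ π = head (rixβ π)

maxIncSuffix : List ℕ → List ℕ
maxIncSuffix [] = []
maxIncSuffix (a ∷ w) with isIncreasing (a ∷ w)
... | true = a ∷ w
... | false = maxIncSuffix w

InRix : List ℕ → ℕ → Set
InRix π y = y ∈ maxIncSuffix π × ∃[ b ] (β₁ π ≡ just b × b ≤ y)

-- neighbour comparisons with the convention π₀ = π_{n+1} = ∞ (nothing = ∞)
ValBelow : Maybe ℕ → ℕ → Set
ValBelow nothing y = ⊤
ValBelow (just a) y = y < a

ValAbove : Maybe ℕ → ℕ → Set
ValAbove nothing y = ⊥
ValAbove (just a) y = a < y

IsValley : List ℕ → ℕ → Set
IsValley π y = ∃[ u ] ∃[ v ] (π ≡ u ++ y ∷ v × ValBelow (last u) y × ValBelow (head v) y)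

IsDoubleAscent : List ℕ → ℕ → Set
IsDoubleAscent π y = ∃[ u ] ∃[ v ] (π ≡ u ++ y ∷ v × ValAbove (last u) y × ValBelow (head v) y)

-- Both β and the maximal increasing suffix s of π are suffixes entered through a descent, and
-- every descent of β is at most β₁ (the algorithm stops only when β has no descent or starts with
-- its largest one). Comparing where the two suffixes begin gives head s ≤ β₁: if β starts before
-- s, the descent into s lies in β. A rixed point y lies in s, so its right neighbour is larger.
-- If y = β₁, its left neighbour ends the prefix α₁⋯α_k and descends onto β₁; π has no repeated
-- letters, so this is the only occurrence of y. If y > β₁ ≥ head s, then y is not the first
-- letter of s, and its left neighbour in s is smaller.

module Submission where

open import Defs
open import Data.Nat using (ℕ)
open import Data.List using (List)
open import Data.Maybe using (just)
open import Data.Product using (_×_)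
open import Relation.Binary.PropositionalEquality using (_≡_; _≢_)

open import Data.Bool using (true; false)
open import Data.Empty using (⊥-elim)
open import Data.List using ([]; _∷_; _++_; _∷ʳ_; [_]; head; last; length; foldr)
open import Data.List.Properties using (++-assoc; ∷ʳ-++; ∷-injective; foldr-preservesᵒ)
open import Data.List.Membership.Propositional using (_∈_; _∉_)
open import Data.List.Membership.Propositional.Properties using (∈-∃++; ∈-++⁺ʳ; foldr-selective)
open import Data.List.Relation.Unary.All as All using (_∷_)
open import Data.List.Relation.Unary.Any as Any using (here; there)
open import Data.List.Relation.Unary.AllPairs using (_∷_)
open import Data.List.Relation.Unary.Linked as Linked using (Linked; []; [-]; _∷_)
open import Data.List.Relation.Unary.Linked.Properties using (Linked⇒AllPairs)
open import Data.List.Relation.Unary.Unique.Propositional using (Unique)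
open import Data.List.Relation.Unary.Unique.Propositional.Properties
  using (map⁺; upTo⁺; drop⁺; Unique[x∷xs]⇒x∉xs)
open import Data.List.Relation.Binary.Permutation.Propositional using (↭-sym; ↭⇒↭ₛ)
import Data.List.Relation.Binary.Permutation.Setoid.Properties as Permutationₛ
open import Data.List.Reverse using (reverseView; []; _∶_∶ʳ_)
open import Data.Maybe.Properties using (just-injective)
open import Data.Maybe.Relation.Binary.Connected
  using (Connected; just; just-nothing; nothing-just; nothing)
open import Data.Nat using (zero; suc; s≤s⁻¹; _<_; _≤_; _>_; _⊔_; _<ᵇ_; _≡ᵇ_)
open import Data.Nat.Properties
open import Data.Product using (∃-syntax; _,_; proj₁; proj₂; map₁)
open import Data.Sum using (_⊎_; inj₁; inj₂; [_,_]′)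
open import Data.Unit using (tt)
open import Function using (_∘_; case_of_)
open import Relation.Binary.PropositionalEquality using (refl; sym; trans; cong; subst; setoid)
open import Relation.Nullary.Reflects using (Reflects; ofʸ; ofⁿ; fromEquivalence)

last-++-∷ : ∀ {A : Set} (u : List A) {x} v → last (u ++ x ∷ v) ≡ last (x ∷ v)
last-++-∷ []          v = refl
last-++-∷ (a ∷ [])    v = refl
last-++-∷ (a ∷ b ∷ u) v = last-++-∷ (b ∷ u) v

head-just : ∀ {A : Set} (xs : List A) {x} → head xs ≡ just x → ∃[ ys ] (xs ≡ x ∷ ys)
head-just (x ∷ xs) refl = xs , refl

++-≡-++ : ∀ {A : Set} (q s p β : List A) → q ++ s ≡ p ++ β →
          (∃[ r ] (s ≡ r ++ β)) ⊎ (∃[ r ] (q ≡ p ++ r × β ≡ r ++ s))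
++-≡-++ []      s p       β eq = inj₁ (p , eq)
++-≡-++ (a ∷ q) s []      β eq = inj₂ (a ∷ q , refl , sym eq)
++-≡-++ (a ∷ q) s (b ∷ p) β eq with ∷-injective eq
... | refl , eq′ with ++-≡-++ q s p β eq′
...   | inj₁ split         = inj₁ split
...   | inj₂ (r , q≡ , β≡) = inj₂ (r , cong (a ∷_) q≡ , β≡)

Unique-++⁻ʳ : ∀ {A : Set} (u : List A) {v} → Unique (u ++ v) → Unique v
Unique-++⁻ʳ []      uniq       = uniq
Unique-++⁻ʳ (_ ∷ u) (_ ∷ uniq) = Unique-++⁻ʳ u uniq

Unique-split : ∀ {A : Set} (u u′ : List A) {x v v′} → Unique (u ++ x ∷ v) →
               u ++ x ∷ v ≡ u′ ++ x ∷ v′ → u ≡ u′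
Unique-split []      []       _    _    = refl
Unique-split []      (a ∷ u′) uniq refl = ⊥-elim (Unique[x∷xs]⇒x∉xs uniq (∈-++⁺ʳ u′ (here refl)))
Unique-split (a ∷ u) []       uniq refl = ⊥-elim (Unique[x∷xs]⇒x∉xs uniq (∈-++⁺ʳ u (here refl)))
Unique-split (a ∷ u) (b ∷ u′) (_ ∷ uniq) eq with ∷-injective eq
... | refl , eq′ = cong (a ∷_) (Unique-split u u′ uniq eq′)

IsPerm⇒Unique : ∀ n {π} → IsPerm n π → Unique π
IsPerm⇒Unique n perm = Permutationₛ.Unique-resp-↭ (setoid ℕ) (↭⇒↭ₛ (↭-sym perm))
  (map⁺ suc-injective (upTo⁺ n))

Linked-++⁻ʳ : ∀ {A : Set} {R : A → A → Set} (u : List A) {v} → Linked R (u ++ v) → Linked R v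
Linked-++⁻ʳ []      chain = chain
Linked-++⁻ʳ (_ ∷ u) chain = Linked-++⁻ʳ u (Linked.tail chain)

Unique∧Linked≤⇒Linked< : ∀ {w} → Unique w → Linked _≤_ w → Linked _<_ w
Unique∧Linked≤⇒Linked< _                   []          = []
Unique∧Linked≤⇒Linked< _                   [-]         = [-]
Unique∧Linked≤⇒Linked< ((a≢b ∷ _) ∷ uniq) (a≤b ∷ chain) =
  ≤∧≢⇒< a≤b a≢b ∷ Unique∧Linked≤⇒Linked< uniq chain

DescentAt : List ℕ → ℕ → Set
DescentAt w x = ∃[ u ] ∃[ c ] ∃[ v ] (w ≡ u ++ x ∷ c ∷ v × c < x)

DescentAt-∷ : ∀ a {w x} → DescentAt w x → DescentAt (a ∷ w) x
DescentAt-∷ a (u , c , v , eq , c<x) = a ∷ u , c , v , cong (a ∷_) eq , c<x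

∈-descents-∷⁻ : ∀ a w {x} → x ∈ descents (a ∷ w) → DescentAt (a ∷ w) x ⊎ x ∈ descents w
∈-descents-∷⁻ a (b ∷ w) x∈ with b <ᵇ a | <ᵇ-reflects-< b a
∈-descents-∷⁻ a (b ∷ w) (here refl) | true  | ofʸ b<a = inj₁ ([] , b , w , refl , b<a)
∈-descents-∷⁻ a (b ∷ w) (there x∈)  | true  | _       = inj₂ x∈
∈-descents-∷⁻ a (b ∷ w) x∈          | false | _       = inj₂ x∈

∈-descents⁻ : ∀ w {x} → x ∈ descents w → DescentAt w x
∈-descents⁻ (a ∷ w) x∈ with ∈-descents-∷⁻ a w x∈
... | inj₁ at  = at
... | inj₂ x∈′ = DescentAt-∷ a (∈-descents⁻ w x∈′)

∈-descents-∷⁺ : ∀ a w {x} → x ∈ descents w → x ∈ descents (a ∷ w)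
∈-descents-∷⁺ a (b ∷ w) x∈ with b <ᵇ a
... | true  = there x∈
... | false = x∈

∈-descents⁺ : ∀ {w x} → DescentAt w x → x ∈ descents w
∈-descents⁺ (u , c , v , refl , c<x) = at u c<x
  where
  at : ∀ u {x c v} → c < x → x ∈ descents (u ++ x ∷ c ∷ v)
  at [] {x} {c} c<x with c <ᵇ x | <ᵇ-reflects-< c x
  ... | true  | _        = here refl
  ... | false | ofⁿ c≮x = ⊥-elim (c≮x c<x)
  at (a ∷ u) c<x = ∈-descents-∷⁺ a (u ++ _) (at u c<x)

∈-descents-seam : ∀ x u {c v} → Connected _>_ (last (x ∷ u)) (just c) →
                  ∃[ d ] (c < d × d ∈ descents (x ∷ u ++ c ∷ v))
∈-descents-seam x []      {c} {v} (just c<x) = x , c<x , ∈-descents⁺ ([] , c , v , refl , c<x)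
∈-descents-seam x (y ∷ u) {c} {v} seam with ∈-descents-seam y u {v = v} seam
... | d , c<d , d∈ = d , c<d , ∈-descents-∷⁺ x (y ∷ u ++ c ∷ v) d∈

isIncreasing⇒∉descents : ∀ w {x} → isIncreasing w ≡ true → x ∉ descents w
isIncreasing⇒∉descents w inc x∈ with descents w
isIncreasing⇒∉descents w () (here _) | _ ∷ _

NoDescent⇒Linked : ∀ w → (∀ {x} → x ∉ descents w) → Linked _≤_ w
NoDescent⇒Linked []          _    = []
NoDescent⇒Linked (a ∷ [])    _    = [-]
NoDescent⇒Linked (a ∷ b ∷ w) none =
  ≮⇒≥ (λ b<a → none (∈-descents⁺ ([] , b , w , refl , b<a))) ∷
  NoDescent⇒Linked (b ∷ w) (none ∘ ∈-descents-∷⁺ a (b ∷ w))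

foldr-⊔-∈ : ∀ x xs → foldr _⊔_ 0 (x ∷ xs) ∈ x ∷ xs
foldr-⊔-∈ x xs with foldr-selective ⊔-sel 0 (x ∷ xs)
... | inj₂ max∈ = max∈
... | inj₁ max≡0 = here (trans max≡0 (sym (n≤0⇒n≡0 (subst (x ≤_) max≡0 (m≤m⊔n x _)))))

largestDescent∈descents : ∀ w → isIncreasing w ≡ false → largestDescent w ∈ descents w
largestDescent∈descents w notInc with descents w
... | d ∷ ds = foldr-⊔-∈ d ds

≤-largestDescent : ∀ w {d} → d ∈ descents w → d ≤ largestDescent w
≤-largestDescent w d∈ = foldr-preservesᵒ
  (λ x y → [ (λ d≤x → ≤-trans d≤x (m≤m⊔n x y)) , (λ d≤y → ≤-trans d≤y (m≤n⊔m x y)) ]′)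
  0 (descents w) (inj₂ (Any.map ≤-reflexive d∈))

≡ᵇ-reflects-≡ : ∀ m n → Reflects (m ≡ n) (m ≡ᵇ n)
≡ᵇ-reflects-≡ m n = fromEquivalence (≡ᵇ⇒≡ m n) (≡⇒≡ᵇ m n)

splitAround-++ : ∀ u {x v} → Unique (u ++ x ∷ v) → splitAround x (u ++ x ∷ v) ≡ (u , v)
splitAround-++ [] {x} _ with x ≡ᵇ x | ≡ᵇ-reflects-≡ x x
... | true  | _        = refl
... | false | ofⁿ x≢x = ⊥-elim (x≢x refl)
splitAround-++ (a ∷ u) {x} (a∉ ∷ uniq) with a ≡ᵇ x | ≡ᵇ-reflects-≡ a x
... | true  | ofʸ a≡x = ⊥-elim (All.lookup a∉ (∈-++⁺ʳ u (here refl)) a≡x)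
... | false | _        rewrite splitAround-++ u uniq = refl

-- Vacuous when u or v is empty.
DescendsInto : List ℕ → List ℕ → Set
DescendsInto u v = Connected _>_ (last u) (head v)

DescendsInto-[]ˡ : ∀ v → DescendsInto [] v
DescendsInto-[]ˡ []      = nothing
DescendsInto-[]ˡ (_ ∷ _) = nothing-just

DescendsInto-∷ : ∀ {x} p {s} → (p ≡ [] → DescendsInto [ x ] s) → DescendsInto p s →
                 DescendsInto (x ∷ p) s
DescendsInto-∷ []      seam _    = seam refl
DescendsInto-∷ (_ ∷ _) _    seam = seam

DescendsInto-++ˡ : ∀ u {x v s} → DescendsInto (x ∷ v) s → DescendsInto (u ++ x ∷ v) s
DescendsInto-++ˡ u {v = v} {s} = subst (λ m → Connected _>_ m (head s)) (sym (last-++-∷ u v))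

record DescentSuffix (w s : List ℕ) : Set where
  field
    prefix   : List ℕ
    splits   : w ≡ prefix ++ s
    descends : DescendsInto prefix s

DescentSuffix-refl : ∀ w → DescentSuffix w w
DescentSuffix-refl w = record { prefix = [] ; splits = refl ; descends = DescendsInto-[]ˡ w }

DescentSuffix-∷ : ∀ {x w s} → (w ≡ s → DescendsInto [ x ] s) → DescentSuffix w s →
                  DescentSuffix (x ∷ w) s
DescentSuffix-∷ {x} seam record { prefix = p ; splits = w≡ ; descends = d } = record
  { prefix   = x ∷ p
  ; splits   = cong (x ∷_) w≡
  ; descends = DescendsInto-∷ p (λ { refl → seam w≡ }) d
  }

DescentSuffix-++-∷ : ∀ u {x w s} → DescendsInto [ x ] w → DescentSuffix w s →
                     DescentSuffix (u ++ x ∷ w) s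
DescentSuffix-++-∷ u {x} {s = s} seam record { prefix = p ; splits = w≡ ; descends = d } = record
  { prefix   = u ++ x ∷ p
  ; splits   = trans (cong (λ w → u ++ x ∷ w) w≡) (sym (++-assoc u (x ∷ p) s))
  ; descends = DescendsInto-++ˡ u
                 (DescendsInto-∷ p (λ { refl → subst (DescendsInto [ x ]) w≡ seam }) d)
  }

isIncreasing-∷ : ∀ a w → isIncreasing (a ∷ w) ≡ false → isIncreasing w ≡ true →
                 DescendsInto [ a ] w
isIncreasing-∷ a (b ∷ w) notInc inc with b <ᵇ a | <ᵇ-reflects-< b a
... | true  | ofʸ b<a = just b<a
... | false | _       = case trans (sym inc) notInc of λ ()

isIncreasing-maxIncSuffix : ∀ w → isIncreasing (maxIncSuffix w) ≡ true
isIncreasing-maxIncSuffix []      = refl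
isIncreasing-maxIncSuffix (a ∷ w) with isIncreasing (a ∷ w) in inc
... | true  = inc
... | false = isIncreasing-maxIncSuffix w

maxIncSuffix-DescentSuffix : ∀ w → DescentSuffix w (maxIncSuffix w)
maxIncSuffix-DescentSuffix []      = DescentSuffix-refl []
maxIncSuffix-DescentSuffix (a ∷ w) with isIncreasing (a ∷ w) in notInc
... | true  = DescentSuffix-refl (a ∷ w)
... | false = DescentSuffix-∷ seam (maxIncSuffix-DescentSuffix w)
  where
  seam : w ≡ maxIncSuffix w → DescendsInto [ a ] (maxIncSuffix w)
  seam w≡ = subst (DescendsInto [ a ]) w≡
    (isIncreasing-∷ a w notInc
      (subst (λ v → isIncreasing v ≡ true) (sym w≡) (isIncreasing-maxIncSuffix w)))

maxIncSuffix-increasing : ∀ {w} → Unique w → Linked _<_ (maxIncSuffix w)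
maxIncSuffix-increasing {w} uniq = Unique∧Linked≤⇒Linked<
  (Unique-++⁻ʳ prefix (subst Unique splits uniq))
  (NoDescent⇒Linked _ (isIncreasing⇒∉descents (maxIncSuffix w) (isIncreasing-maxIncSuffix w)))
  where open DescentSuffix (maxIncSuffix-DescentSuffix w)

HeadBoundsDescents : List ℕ → Set
HeadBoundsDescents β = ∀ {b d} → head β ≡ just b → d ∈ descents β → d ≤ b

length-<-++-∷ : ∀ {A : Set} (u : List A) {x v} → length v < length (u ++ x ∷ v)
length-<-++-∷ []      = ≤-refl
length-<-++-∷ (_ ∷ u) = m<n⇒m<1+n (length-<-++-∷ u)

-- The bound length w ≤ f makes the fuel outlast the algorithm: each round drops w′x ≠ [].
rixβ-fuel-invariant : ∀ f w → length w ≤ f → Unique w →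
                      DescentSuffix w (rixβ-fuel f w) × HeadBoundsDescents (rixβ-fuel f w)
rixβ-fuel-invariant zero [] _ _ = DescentSuffix-refl [] , λ ()
rixβ-fuel-invariant (suc f) w len uniq with isIncreasing w in inc
... | true  = DescentSuffix-refl w , λ _ d∈ → ⊥-elim (isIncreasing⇒∉descents w inc d∈)
... | false with ∈-descents⁻ w (largestDescent∈descents w inc)
...   | [] , c , v , w≡ , _
  rewrite trans (cong (splitAround _) w≡) (splitAround-++ [] (subst Unique w≡ uniq)) =
    DescentSuffix-refl w , bound
  where
  bound : HeadBoundsDescents w
  bound hb d∈ =
    subst (_ ≤_) (just-injective (trans (sym (cong head w≡)) hb)) (≤-largestDescent w d∈)
...   | a ∷ u , c , v , w≡ , c<x
  rewrite trans (cong (splitAround _) w≡) (splitAround-++ (a ∷ u) (subst Unique w≡ uniq)) =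
    map₁ extend (rixβ-fuel-invariant f (c ∷ v) len′ uniq′)
  where
  len′ : length (c ∷ v) ≤ f
  len′ = s≤s⁻¹ (≤-trans (length-<-++-∷ (a ∷ u)) (subst (λ w → length w ≤ suc f) w≡ len))
  uniq′ : Unique (c ∷ v)
  uniq′ = drop⁺ 1 (Unique-++⁻ʳ (a ∷ u) (subst Unique w≡ uniq))
  extend : ∀ {β} → DescentSuffix (c ∷ v) β → DescentSuffix w β
  extend suffix =
    subst (λ w → DescentSuffix w _) (sym w≡) (DescentSuffix-++-∷ (a ∷ u) (just c<x) suffix)

rixβ-invariant : ∀ {π} → Unique π → DescentSuffix π (rixβ π) × HeadBoundsDescents (rixβ π)
rixβ-invariant {π} = rixβ-fuel-invariant (length π) π ≤-refl

Linked<⇒head≤ : ∀ {c s x} → Linked _<_ (c ∷ s) → x ∈ c ∷ s → c ≤ x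
Linked<⇒head≤ _     (here refl) = ≤-refl
Linked<⇒head≤ chain (there x∈)  with Linked⇒AllPairs <-trans chain
... | c<s ∷ _ = <⇒≤ (All.lookup c<s x∈)

DescentSuffix-head≤ : ∀ {w β s b c} → DescentSuffix w β → HeadBoundsDescents β →
                      DescentSuffix w s → Linked _<_ s →
                      head β ≡ just b → head s ≡ just c → c ≤ b
DescentSuffix-head≤ {β = b ∷ β′} {c ∷ s′} record { prefix = p ; splits = w≡pβ } β-bound
                    record { prefix = q ; splits = w≡qs ; descends = seam } s-chain refl refl
  with ++-≡-++ q (c ∷ s′) p (b ∷ β′) (trans (sym w≡qs) w≡pβ)
... | inj₁ (r , s≡) = Linked<⇒head≤ s-chain (subst (b ∈_) (sym s≡) (∈-++⁺ʳ r (here refl)))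
... | inj₂ ([] , _ , refl) = ≤-refl
... | inj₂ (x ∷ r , refl , β≡)
  with ∈-descents-seam x r (subst (λ m → Connected _>_ m (just c)) (last-++-∷ p r) seam)
...   | d , c<d , d∈ =
  <⇒≤ (<-≤-trans c<d (β-bound refl (subst (λ v → d ∈ descents v) (sym β≡) d∈)))

Connected⇒ValBelowˡ : ∀ {m y} → Connected _>_ m (just y) → ValBelow m y
Connected⇒ValBelowˡ (just y<a)   = y<a
Connected⇒ValBelowˡ nothing-just = tt

Connected⇒ValBelowʳ : ∀ {m y} → Connected _<_ (just y) m → ValBelow m y
Connected⇒ValBelowʳ (just y<a)   = y<a
Connected⇒ValBelowʳ just-nothing = tt

module RixedPoints {π β s : List ℕ} (uniq : Unique π)
                   (β-suffix : DescentSuffix π β) (β-bound : HeadBoundsDescents β)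
                   (s-suffix : DescentSuffix π s) (s-chain : Linked _<_ s) where

  open DescentSuffix β-suffix renaming (prefix to p; splits to π≡pβ; descends to p↘β)
  open DescentSuffix s-suffix renaming (prefix to q; splits to π≡qs)

  position : ∀ {y} → y ∈ s →
             ∃[ s₁ ] ∃[ s₂ ] (s ≡ s₁ ++ y ∷ s₂ × π ≡ (q ++ s₁) ++ y ∷ s₂ × ValBelow (head s₂) y)
  position {y} y∈s with ∈-∃++ y∈s
  ... | s₁ , s₂ , s≡ = s₁ , s₂ , s≡ , π≡ ,
        Connected⇒ValBelowʳ (Linked.head′ (Linked-++⁻ʳ s₁ (subst (Linked _<_) s≡ s-chain)))
    where
    π≡ : π ≡ (q ++ s₁) ++ y ∷ s₂
    π≡ = trans π≡qs (trans (cong (q ++_) s≡) (sym (++-assoc q s₁ (y ∷ s₂))))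

  valley : ∀ {y} → head β ≡ just y → y ∈ s → IsValley π y
  valley {y} hy y∈s with position y∈s | head-just β hy
  ... | s₁ , s₂ , _ , π≡ , right | β′ , β≡ = q ++ s₁ , s₂ , π≡ , left , right
    where
    q++s₁≡p : q ++ s₁ ≡ p
    q++s₁≡p = Unique-split (q ++ s₁) p (subst Unique π≡ uniq)
                (trans (sym π≡) (trans π≡pβ (cong (p ++_) β≡)))
    left : ValBelow (last (q ++ s₁)) y
    left = subst (λ u → ValBelow (last u) y) (sym q++s₁≡p)
             (Connected⇒ValBelowˡ (subst (DescendsInto p) β≡ p↘β))

  doubleAscent : ∀ {b y} → head β ≡ just b → b < y → y ∈ s → IsDoubleAscent π y
  doubleAscent {b} {y} hb b<y y∈s with position y∈s
  ... | s₁ , s₂ , s≡ , π≡ , right with reverseView s₁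
  ...   | [] =
    ⊥-elim (<⇒≱ b<y (DescentSuffix-head≤ β-suffix β-bound s-suffix s-chain hb (cong head s≡)))
  ...   | s₁′ ∶ _ ∶ʳ a = (q ++ s₁′) ∷ʳ a , s₂ , π≡′ , left , right
    where
    π≡′ : π ≡ ((q ++ s₁′) ∷ʳ a) ++ y ∷ s₂
    π≡′ = trans π≡ (cong (_++ y ∷ s₂) (sym (++-assoc q s₁′ [ a ])))
    a<y : a < y
    a<y = Linked.head
            (Linked-++⁻ʳ s₁′ (subst (Linked _<_) (trans s≡ (∷ʳ-++ s₁′ a (y ∷ s₂))) s-chain))
    left : ValAbove (last ((q ++ s₁′) ∷ʳ a)) y
    left = subst (λ m → ValAbove m y) (sym (last-++-∷ (q ++ s₁′) [])) a<y

lemma19 : (n : ℕ) (π : List ℕ) → IsPerm n π → (y : ℕ) → InRix π y →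
    (just y ≡ β₁ π → IsValley π y) × (just y ≢ β₁ π → IsDoubleAscent π y)
lemma19 n π perm y (y∈s , b , β₁≡b , b≤y) = (λ y≡β₁ → valley (sym y≡β₁) y∈s) , ascent
  where
  uniq : Unique π
  uniq = IsPerm⇒Unique n perm
  open RixedPoints uniq (proj₁ (rixβ-invariant uniq)) (proj₂ (rixβ-invariant uniq))
                        (maxIncSuffix-DescentSuffix π) (maxIncSuffix-increasing uniq)
  ascent : just y ≢ β₁ π → IsDoubleAscent π y
  ascent y≢β₁ = doubleAscent β₁≡b (≤∧≢⇒< b≤y b≢y) y∈s
    where
    b≢y : b ≢ y
    b≢y refl = y≢β₁ (sym β₁≡b)
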